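{- Let $\Omega'$ be a non-empty subset of a finite set $\Omega$, let $\mathcal{H}$ be a hypergraph on $\Omega$, and let $\mathcal{H}[\Omega']=\{A\in\mathcal{H}: A\subseteq\Omega'\}$. Let $G'$ be a graph with vertex set $V(G')\subseteq\Omega'$, and suppose $\mathcal{H}[\Omega']\neq\emptyset$. Then $\mathcal{H}[\Omega']\leqslant\mathcal{D}(G')$ if and only if $\mathcal{H}\leqslant\mathcal{D}(G'\vee K_{\Omega\setminus\Omega'})$.
   Context: Graphs are finite, simple, undirected; $\mathcal{D}(G)$ is the family of inclusion-minimal dominating sets of $G$ (a dominating set is $D\subseteq V(G)$ such that every vertex outside $D$ has a neighbour in $D$). A hypergraph on $\Omega$ is a nonempty family of nonempty subsets of $\Omega$, none a proper subset of another. For families $\mathcal{H}_1,\mathcal{H}_2$ of sets, $\mathcal{H}_1\leqslant\mathcal{H}_2$ means: for every $A_1\in\mathcal{H}_1$ there is $A_2\in\mathcal{H}_2$ with $A_2\subseteq A_1$. $K_X$ is the complete graph on vertex set $X$. The join $G_1\vee G_2$ of graphs with disjoint vertex sets has vertex set $V(G_1)\cup V(G_2)$ and edge set $E(G_1)\cup E(G_2)\cup\{\{x,y\}:x\in V(G_1),y\in V(G_2)\}$. -}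

module Defs where

open import Data.Nat using (ℕ)
open import Data.Fin using (Fin)
open import Data.Fin.Subset using (Subset; _∈_; _∉_; _⊆_; _∪_; ∁; Nonempty)
open import Data.Product using (_×_; Σ; ∃; _,_; proj₁; proj₂)
open import Data.Sum using (_⊎_)
open import Relation.Nullary using (¬_)
open import Relation.Binary.PropositionalEquality using (_≡_; _≢_)
open import Level using (0ℓ; suc)

-- The finite ground set Ω is Fin n; subsets of Ω are Subset n.
-- A family of subsets of Ω is a predicate on Subset n.
Family : ℕ → Set₁
Family n = Subset n → Set

record IsHypergraph {n : ℕ} (H : Family n) : Set where
  field
    nonempty-family  : ∃ λ A → H A
    nonempty-members : ∀ A → H A → Nonempty A
    sperner          : ∀ A B → H A → H B → A ⊆ B → A ≡ B

_≼_ : {n : ℕ} → Family n → Family n → Set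
H₁ ≼ H₂ = ∀ A₁ → H₁ A₁ → ∃ λ A₂ → H₂ A₂ × A₂ ⊆ A₁

_[_] : {n : ℕ} → Family n → Subset n → Family n
(H [ Ω' ]) A = H A × A ⊆ Ω'

record Graph (n : ℕ) : Set₁ where
  field
    V     : Subset n
    E     : Fin n → Fin n → Set
    E-sym : ∀ {x y} → E x y → E y x
    E-irr : ∀ {x} → ¬ E x x
    E-V   : ∀ {x y} → E x y → x ∈ V × y ∈ V
open Graph public

IsDominating : {n : ℕ} → Graph n → Subset n → Set
IsDominating G D = D ⊆ V G × (∀ v → v ∈ V G → v ∉ D → ∃ λ u → u ∈ D × E G v u)

IsMinDominating : {n : ℕ} → Graph n → Subset n → Set
IsMinDominating G D =
  IsDominating G D × (∀ D' → D' ⊆ D → IsDominating G D' → D ⊆ D')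

𝒟 : {n : ℕ} → Graph n → Family n
𝒟 G = IsMinDominating G

K : {n : ℕ} → Subset n → Graph n
K X = record
  { V = X
  ; E = λ x y → x ∈ X × y ∈ X × x ≢ y
  ; E-sym = λ { (x∈ , y∈ , x≢y) → y∈ , x∈ , λ eq → x≢y (Relation.Binary.PropositionalEquality.sym eq) }
  ; E-irr = λ { (_ , _ , x≢x) → x≢x Relation.Binary.PropositionalEquality.refl }
  ; E-V = λ { (x∈ , y∈ , _) → x∈ , y∈ }
  }

Disjoint : {n : ℕ} → Subset n → Subset n → Set
Disjoint A B = ∀ x → x ∈ A → x ∉ B

join : {n : ℕ} (G₁ G₂ : Graph n) → Disjoint (V G₁) (V G₂) → Graph n
join G₁ G₂ disj = record
  { V = V G₁ ∪ V G₂
  ; E = Ej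
  ; E-sym = sym'
  ; E-irr = irr'
  ; E-V = ev
  }
  where
  open import Data.Sum using (inj₁; inj₂)
  open import Data.Fin.Subset.Properties using (p⊆p∪q; q⊆p∪q)
  Ej : Fin _ → Fin _ → Set
  Ej x y = E G₁ x y ⊎ (E G₂ x y ⊎ ((x ∈ V G₁ × y ∈ V G₂) ⊎ (x ∈ V G₂ × y ∈ V G₁)))
  sym' : ∀ {x y} → Ej x y → Ej y x
  sym' (inj₁ e) = inj₁ (E-sym G₁ e)
  sym' (inj₂ (inj₁ e)) = inj₂ (inj₁ (E-sym G₂ e))
  sym' (inj₂ (inj₂ (inj₁ (a , b)))) = inj₂ (inj₂ (inj₂ (b , a)))
  sym' (inj₂ (inj₂ (inj₂ (a , b)))) = inj₂ (inj₂ (inj₁ (b , a)))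
  irr' : ∀ {x} → ¬ Ej x x
  irr' (inj₁ e) = E-irr G₁ e
  irr' (inj₂ (inj₁ e)) = E-irr G₂ e
  irr' {x} (inj₂ (inj₂ (inj₁ (a , b)))) = disj x a b
  irr' {x} (inj₂ (inj₂ (inj₂ (a , b)))) = disj x b a
  ev : ∀ {x y} → Ej x y → x ∈ (V G₁ ∪ V G₂) × y ∈ (V G₁ ∪ V G₂)
  ev (inj₁ e) = p⊆p∪q (V G₂) (proj₁ (E-V G₁ e)) , p⊆p∪q (V G₂) (proj₂ (E-V G₁ e))
  ev (inj₂ (inj₁ e)) = q⊆p∪q (V G₁) (V G₂) (proj₁ (E-V G₂ e)) , q⊆p∪q (V G₁) (V G₂) (proj₂ (E-V G₂ e))
  ev (inj₂ (inj₂ (inj₁ (a , b)))) = p⊆p∪q (V G₂) a , q⊆p∪q (V G₁) (V G₂) b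
  ev (inj₂ (inj₂ (inj₂ (a , b)))) = q⊆p∪q (V G₁) (V G₂) a , p⊆p∪q (V G₂) b

⊆⇒disj∁ : {n : ℕ} (Ω' : Subset n) (G' : Graph n) → V G' ⊆ Ω' → Disjoint (V G') (V (K (∁ Ω')))
⊆⇒disj∁ Ω' G' sub x x∈V x∈∁ = Data.Fin.Subset.Properties.x∈∁p⇒x∉p x∈∁ (sub x∈V)
  where import Data.Fin.Subset.Properties

joinK : {n : ℕ} (Ω' : Subset n) (G' : Graph n) → V G' ⊆ Ω' → Graph n
joinK Ω' G' sub = join G' (K (∁ Ω')) (⊆⇒disj∁ Ω' G' sub)

-- A minimal dominating set of G' stays one in J = G' ∨ K_X (X = Ω ∖ Ω'):
-- every vertex of X is adjacent to all of V(G') and the dominating set is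
-- nonempty, while between vertices of V(G') the join adds no edges.
-- Conversely a minimal dominating set of J inside Ω' avoids X, hence is one
-- of G'. Every vertex of X is universal in J, so each A ∈ H meeting X contains
-- a minimal dominating singleton of J; all other A lie in H[Ω'].
module Submission where

open import Defs
open import Data.Nat using (ℕ)
open import Data.Fin using (Fin)
open import Data.Fin.Subset using (Subset; _⊆_; Nonempty; _∈_; _∉_; ∁; ⁅_⁆; _∩_)
open import Data.Fin.Subset.Properties
  using (_∈?_; nonempty?; x∈⁅x⁆; x∈⁅y⁆⇒x≡y; x∈∁p⇒x∉p; x∉∁p⇒x∈p; x∈p∪q⁻; x∈p∪q⁺; x∈p∩q⁺; x∈p∩q⁻)
open import Data.Product using (_×_; ∃; _,_; proj₁)
open import Data.Sum using (_⊎_; inj₁; inj₂)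
open import Data.Empty using (⊥-elim)
open import Relation.Nullary using (yes; no)
open import Relation.Binary.PropositionalEquality using (_≢_; refl; subst; sym)
open import Function.Bundles using (_⇔_; mk⇔)

⊆⊎∃∈∁ : {n : ℕ} (A Ω' : Subset n) → A ⊆ Ω' ⊎ ∃ λ x → x ∈ A × x ∈ ∁ Ω'
⊆⊎∃∈∁ A Ω' with nonempty? (A ∩ ∁ Ω')
... | yes (x , x∈A∩∁Ω') = inj₂ (x , x∈p∩q⁻ A (∁ Ω') x∈A∩∁Ω')
... | no ¬meets = inj₁ λ x∈A → x∉∁p⇒x∈p λ x∈∁Ω' → ¬meets (_ , x∈p∩q⁺ (x∈A , x∈∁Ω'))

module _ {n : ℕ} (G : Graph n) where

  dominating-nonempty : Nonempty (V G) → ∀ D → IsDominating G D → Nonempty D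
  dominating-nonempty (w , w∈V) D (_ , dom) with w ∈? D
  ... | yes w∈D = w , w∈D
  ... | no w∉D with dom w w∈V w∉D
  ... | u , u∈D , _ = u , u∈D

  IsUniversal : Fin n → Set
  IsUniversal x = x ∈ V G × (∀ v → v ∈ V G → v ≢ x → E G v x)

  universal⇒⁅⁆-minDominating : ∀ {x} → IsUniversal x → IsMinDominating G ⁅ x ⁆
  universal⇒⁅⁆-minDominating {x} (x∈V , adj) = (⁅x⁆⊆V , dominates) , minimal
    where
    ⁅x⁆⊆V : ⁅ x ⁆ ⊆ V G
    ⁅x⁆⊆V y∈⁅x⁆ = subst (_∈ V G) (sym (x∈⁅y⁆⇒x≡y x y∈⁅x⁆)) x∈V

    dominates : ∀ v → v ∈ V G → v ∉ ⁅ x ⁆ → ∃ λ u → u ∈ ⁅ x ⁆ × E G v u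
    dominates v v∈V v∉⁅x⁆ = x , x∈⁅x⁆ x , adj v v∈V λ { refl → v∉⁅x⁆ (x∈⁅x⁆ x) }

    minimal : ∀ D' → D' ⊆ ⁅ x ⁆ → IsDominating G D' → ⁅ x ⁆ ⊆ D'
    minimal D' D'⊆⁅x⁆ dom y∈⁅x⁆
      with dominating-nonempty (x , x∈V) D' dom
    ... | u , u∈D' with x∈⁅y⁆⇒x≡y x (D'⊆⁅x⁆ u∈D') | x∈⁅y⁆⇒x≡y x y∈⁅x⁆
    ... | refl | refl = u∈D'

module _ {n : ℕ} (G₁ G₂ : Graph n) (disj : Disjoint (V G₁) (V G₂)) where

  private
    J : Graph n
    J = join G₁ G₂ disj

  join-edge-reflects : ∀ {v u} → v ∈ V G₁ → u ∈ V G₁ → E J v u → E G₁ v u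
  join-edge-reflects v∈ u∈ (inj₁ e) = e
  join-edge-reflects v∈ u∈ (inj₂ (inj₁ e)) = ⊥-elim (disj _ v∈ (proj₁ (E-V G₂ e)))
  join-edge-reflects v∈ u∈ (inj₂ (inj₂ (inj₁ (_ , u∈₂)))) = ⊥-elim (disj _ u∈ u∈₂)
  join-edge-reflects v∈ u∈ (inj₂ (inj₂ (inj₂ (v∈₂ , _)))) = ⊥-elim (disj _ v∈ v∈₂)

  dominating-join⁺ : Nonempty (V G₁) → ∀ D → IsDominating G₁ D → IsDominating J D
  dominating-join⁺ ne D d@(D⊆V , dom) = (λ x∈D → x∈p∪q⁺ (inj₁ (D⊆V x∈D))) , dominates
    where
    dominates : ∀ v → v ∈ V J → v ∉ D → ∃ λ u → u ∈ D × E J v u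
    dominates v v∈V v∉D with x∈p∪q⁻ (V G₁) (V G₂) v∈V
    ... | inj₁ v∈₁ with dom v v∈₁ v∉D
    ... | u , u∈D , e = u , u∈D , inj₁ e
    dominates v v∈V v∉D | inj₂ v∈₂ with dominating-nonempty G₁ ne D d
    ... | u , u∈D = u , u∈D , inj₂ (inj₂ (inj₂ (v∈₂ , D⊆V u∈D)))

  dominating-join⁻ : ∀ D → D ⊆ V G₁ → IsDominating J D → IsDominating G₁ D
  dominating-join⁻ D D⊆V (_ , dom) = D⊆V , dominates
    where
    dominates : ∀ v → v ∈ V G₁ → v ∉ D → ∃ λ u → u ∈ D × E G₁ v u
    dominates v v∈V v∉D with dom v (x∈p∪q⁺ (inj₁ v∈V)) v∉D
    ... | u , u∈D , e = u , u∈D , join-edge-reflects v∈V (D⊆V u∈D) e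

  minDominating-join⁺ : Nonempty (V G₁) → ∀ D → IsMinDominating G₁ D → IsMinDominating J D
  minDominating-join⁺ ne D (d , minimal) = dominating-join⁺ ne D d , λ D' D'⊆D d' →
    minimal D' D'⊆D (dominating-join⁻ D' (λ x∈D' → proj₁ d (D'⊆D x∈D')) d')

  minDominating-join⁻ : Nonempty (V G₁) → ∀ D → (∀ x → x ∈ D → x ∉ V G₂) →
                        IsMinDominating J D → IsMinDominating G₁ D
  minDominating-join⁻ ne D D∩V₂≡∅ ((D⊆V , dom) , minimal) =
    dominating-join⁻ D D⊆V₁ (D⊆V , dom) , λ D' D'⊆D d' → minimal D' D'⊆D (dominating-join⁺ ne D' d')
    where
    D⊆V₁ : D ⊆ V G₁
    D⊆V₁ x∈D with x∈p∪q⁻ (V G₁) (V G₂) (D⊆V x∈D)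
    ... | inj₁ x∈₁ = x∈₁
    ... | inj₂ x∈₂ = ⊥-elim (D∩V₂≡∅ _ x∈D x∈₂)

join-K-universal : {n : ℕ} (G : Graph n) (X : Subset n) (disj : Disjoint (V G) X) →
                   ∀ {x} → x ∈ X → IsUniversal (join G (K X) disj) x
join-K-universal G X disj {x} x∈X = x∈p∪q⁺ (inj₂ x∈X) , adjacent
  where
  adjacent : ∀ v → v ∈ V (join G (K X) disj) → v ≢ x → E (join G (K X) disj) v x
  adjacent v v∈V v≢x with x∈p∪q⁻ (V G) X v∈V
  ... | inj₁ v∈G = inj₂ (inj₂ (inj₁ (v∈G , x∈X)))
  ... | inj₂ v∈X = inj₂ (inj₁ (v∈X , x∈X , v≢x))

lemma4p1 : (n : ℕ) (Ω' : Subset n) → Nonempty Ω' →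
    (H : Family n) → IsHypergraph H →
    (G' : Graph n) → Nonempty (V G') → (sub : V G' ⊆ Ω') →
    (∃ λ A → (H [ Ω' ]) A) →
    ((H [ Ω' ]) ≼ 𝒟 G') ⇔ (H ≼ 𝒟 (joinK Ω' G' sub))
lemma4p1 n Ω' _ H _ G' ne sub _ = mk⇔ to from
  where
  disj : Disjoint (V G') (∁ Ω')
  disj = ⊆⇒disj∁ Ω' G' sub

  to : (H [ Ω' ]) ≼ 𝒟 G' → H ≼ 𝒟 (joinK Ω' G' sub)
  to h A A∈H with ⊆⊎∃∈∁ A Ω'
  ... | inj₂ (x , x∈A , x∈∁Ω') =
    ⁅ x ⁆ ,
    universal⇒⁅⁆-minDominating (joinK Ω' G' sub) (join-K-universal G' (∁ Ω') disj x∈∁Ω') ,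
    λ y∈⁅x⁆ → subst (_∈ A) (sym (x∈⁅y⁆⇒x≡y x y∈⁅x⁆)) x∈A
  ... | inj₁ A⊆Ω' with h A (A∈H , A⊆Ω')
  ... | D , D-min , D⊆A = D , minDominating-join⁺ G' (K (∁ Ω')) disj ne D D-min , D⊆A

  from : H ≼ 𝒟 (joinK Ω' G' sub) → (H [ Ω' ]) ≼ 𝒟 G'
  from h A (A∈H , A⊆Ω') with h A A∈H
  ... | D , D-min , D⊆A =
    D , minDominating-join⁻ G' (K (∁ Ω')) disj ne D (λ _ x∈D x∈∁Ω' → x∈∁p⇒x∉p x∈∁Ω' (A⊆Ω' (D⊆A x∈D))) D-min , D⊆A
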